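{- Let $G$ be a connected simple graph, let $S(G)$ be the set of all spanning trees of $G$, and let $\sigma_{rna}$ be a parity signature of $G$ attaining $\sigma^{ - }(G)$. Then $\sigma^{ - }(G)=1$ if and only if there exists an edge $e\in\bigcap_{T\in S(G)}E(T)$ such that, for every $T\in S(G)$, the set of negative edges of $T$ under $\sigma_{rna}$ (restricted to $E(T)$) is exactly $\{e\}$.
   Context: For a connected simple graph $G$ of order $p$, a parity labelling is a bijection $f:V(G)\to\{1,\ldots,p\}$; it induces a parity signature in which an edge $uv$ is negative if $f(u),f(v)$ have opposite parity and positive otherwise. The rna number $\sigma^{ - }(G)$ is the minimum over all such $f$ of the number of negative edges; a signature attaining this minimum is denoted $\sigma_{rna}$. -}

module Defs where

open import Data.Nat using (ℕ; zero; suc; _+_; _%_; _<ᵇ_; _≡ᵇ_; _≤_)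
open import Data.Nat.Properties
open import Data.Bool using (Bool; true; false; not; _∧_; if_then_else_)
open import Data.Fin using (Fin; toℕ; inject₁; fromℕ) renaming (zero to fzero; suc to fsuc)
open import Data.Fin.Permutation using (Permutation′; _⟨$⟩ʳ_)
open import Data.List using (List; map; allFin)
open import Data.Nat.ListAction using (sum)
open import Data.Product using (Σ; ∃; _×_; _,_)
open import Data.Sum using (_⊎_)
open import Function.Definitions using (Injective)
open import Relation.Binary.PropositionalEquality using (_≡_)

record Graph (p : ℕ) : Set where
  field
    adj   : Fin p → Fin p → Bool
    sym   : ∀ u v → adj u v ≡ adj v u
    irrefl : ∀ u → adj u u ≡ false
open Graph public

data Walk {p : ℕ} (R : Fin p → Fin p → Bool) : Fin p → Fin p → Set where
  here : ∀ {u} → Walk R u u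
  step : ∀ {u v w} → R u v ≡ true → Walk R v w → Walk R u w

Connected : {p : ℕ} → (Fin p → Fin p → Bool) → Set
Connected {p} R = ∀ (u v : Fin p) → Walk R u v

ConnectedGraph : {p : ℕ} → Graph p → Set
ConnectedGraph G = Connected (adj G)

record Cycle {p : ℕ} (R : Fin p → Fin p → Bool) : Set where
  field
    k      : ℕ
    c      : Fin (suc (suc (suc k))) → Fin p
    inj    : Injective _≡_ _≡_ c
    consec : ∀ (i : Fin (suc (suc k))) → R (c (inject₁ i)) (c (fsuc i)) ≡ true
    close  : R (c (fromℕ (suc (suc k)))) (c fzero) ≡ true

Acyclic : {p : ℕ} → (Fin p → Fin p → Bool) → Set
Acyclic R = Cycle R → Data.Empty.⊥
  where import Data.Empty

record SpanningTree {p : ℕ} (G : Graph p) (T : Fin p → Fin p → Bool) : Set where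
  field
    sub  : ∀ u v → T u v ≡ true → adj G u v ≡ true
    tsym : ∀ u v → T u v ≡ T v u
    conn : Connected T
    acyc : Acyclic T

-- Parity labellings: bijections V(G) → {1,…,p}; vertex v gets label
-- suc (toℕ (f v)).
Labelling : ℕ → Set
Labelling p = Permutation′ p

label : {p : ℕ} → Labelling p → Fin p → ℕ
label f v = suc (toℕ (f ⟨$⟩ʳ v))

negB : {p : ℕ} → Labelling p → Fin p → Fin p → Bool
negB f u v = not ((label f u % 2) ≡ᵇ (label f v % 2))

Negative : {p : ℕ} → Labelling p → Fin p → Fin p → Set
Negative f u v = negB f u v ≡ true

negCount : {p : ℕ} → Graph p → Labelling p → ℕ
negCount {p} G f =
  sum (map (λ u → sum (map (λ v →
         if (toℕ u <ᵇ toℕ v) ∧ adj G u v ∧ negB f u v then 1 else 0)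
       (allFin p))) (allFin p))

IsRNA : {p : ℕ} → Graph p → Labelling p → Set
IsRNA {p} G f = ∀ (g : Labelling p) → negCount G f ≤ negCount G g

RnaNumberIs : {p : ℕ} → Graph p → ℕ → Set
RnaNumberIs {p} G m = Σ (Labelling p) (λ f → IsRNA G f × negCount G f ≡ m)

-- An edge of G, as an ordered representative (a , b) with a ~ b.
Edge : {p : ℕ} → Graph p → Set
Edge {p} G = Σ (Fin p) (λ a → Σ (Fin p) (λ b → adj G a b ≡ true))

IsEdge : {p : ℕ} {G : Graph p} → Edge G → Fin p → Fin p → Set
IsEdge (a , b , _) u v = (u ≡ a × v ≡ b) ⊎ (u ≡ b × v ≡ a)

module Submission where

-- The vertices labelled 1 and 2 have different parities, so every walk between them crosses a
-- negative edge: in a connected graph every labelling has a negative edge, and σ⁻(G) = 1 means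
-- that an rna labelling has exactly one negative edge e. A spanning tree joins the ends of e by a
-- walk, which crosses a negative edge of the tree; that edge can only be e, so e lies on every
-- spanning tree and is its only negative edge. Conversely, every edge of G lies on some spanning
-- tree (a breadth-first tree rooted at one of its ends), so if the negative edges of every spanning
-- tree are exactly {e}, then e is the only negative edge of G.

open import Defs hiding (sym)
open import Data.Bool using (Bool; true; false; _∧_; if_then_else_) renaming (_≟_ to _≟ᵇ_)
open import Data.Bool.Properties using (∨-comm; T-≡)
open import Data.Empty using (⊥)
open import Data.Fin using (Fin; toℕ; inject₁; fromℕ; _≟_) renaming (zero to fzero; suc to fsuc)
open import Data.Fin.Permutation using (_⟨$⟩ˡ_; inverseʳ)
open import Data.Fin.Properties using (suc-injective; toℕ-injective; toℕ-inject₁; any?)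
open import Data.List using (tabulate; allFin)
open import Data.List.Extrema.Nat using (argmax; f[xs]≤f[argmax])
open import Data.List.Membership.Propositional.Properties using (∈-allFin)
open import Data.List.Properties using (map-tabulate; tabulate-cong)
open import Data.List.Relation.Unary.All using (lookup)
open import Data.Nat using (ℕ; zero; suc; _+_; _≤_; _<_; z≤n; s≤s; _<ᵇ_; _≡ᵇ_; _%_)
open import Data.Nat.ListAction using (sum)
import Data.Nat.Properties as ℕ
open import Data.Nat.Properties
  using (≤-trans; ≤-reflexive; ≤-pred; <-≤-trans; <-irrefl; <-asym; <-cmp; n<1+n; 1+n≰n; n<1⇒n≡0;
         +-comm; +-identityʳ; +-mono-≤; +-monoʳ-≤; m≤m+n; m≤n+m; m≢1+n+m; <ᵇ⇒<; <⇒<ᵇ; ≡ᵇ⇒≡; ≡⇒≡ᵇ)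
open import Data.Product using (Σ; ∃; ∃₂; _×_; _,_; proj₁; proj₂; swap)
open import Data.Sum using (_⊎_; inj₁; inj₂) renaming (swap to swap⊎)
open import Function using (_∘_; id)
open import Function.Bundles using (_⇔_; mk⇔; Equivalence)
open import Relation.Binary using (DecidableEquality; tri<; tri≈; tri>)
open import Relation.Binary.PropositionalEquality
open import Relation.Nullary using (¬_; Dec; yes; no; does; _because_; invert; _×-dec_; _⊎-dec_; ¬?; contradiction)
open import Relation.Nullary.Decidable using (dec-true)
open import Relation.Unary using (Decidable)

∑ : ∀ {n} → (Fin n → ℕ) → ℕ
∑ h = sum (tabulate h)

term≤∑ : ∀ {n} (h : Fin n → ℕ) i → h i ≤ ∑ h
term≤∑ h fzero = m≤m+n _ _
term≤∑ h (fsuc i) = ≤-trans (term≤∑ (h ∘ fsuc) i) (m≤n+m _ _)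

two-terms≤∑ : ∀ {n} (h : Fin n → ℕ) {i j} → i ≢ j → h i + h j ≤ ∑ h
two-terms≤∑ h {fzero} {fzero} i≢j = contradiction refl i≢j
two-terms≤∑ h {fzero} {fsuc j} _ = +-monoʳ-≤ (h fzero) (term≤∑ (h ∘ fsuc) j)
two-terms≤∑ h {fsuc i} {fzero} _ =
  ≤-trans (≤-reflexive (+-comm (h (fsuc i)) (h fzero))) (+-monoʳ-≤ (h fzero) (term≤∑ (h ∘ fsuc) i))
two-terms≤∑ h {fsuc i} {fsuc j} i≢j = ≤-trans (two-terms≤∑ (h ∘ fsuc) (i≢j ∘ cong fsuc)) (m≤n+m _ _)

∑-zero : ∀ {n} (h : Fin n → ℕ) → (∀ j → h j ≡ 0) → ∑ h ≡ 0
∑-zero {zero} h _ = refl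
∑-zero {suc n} h h≡0 = cong₂ _+_ (h≡0 fzero) (∑-zero (h ∘ fsuc) (h≡0 ∘ fsuc))

∑-single : ∀ {n} (h : Fin n → ℕ) i → (∀ j → j ≢ i → h j ≡ 0) → ∑ h ≡ h i
∑-single h fzero h≡0 =
  trans (cong (h fzero +_) (∑-zero (h ∘ fsuc) (λ j → h≡0 (fsuc j) λ ()))) (+-identityʳ _)
∑-single h (fsuc i) h≡0 =
  cong₂ _+_ (h≡0 fzero λ ()) (∑-single (h ∘ fsuc) i (λ j j≢i → h≡0 (fsuc j) (j≢i ∘ suc-injective)))

module _ {m n : ℕ} (H : Fin m → Fin n → ℕ) where

  ∑² : ℕ
  ∑² = ∑ λ u → ∑ (H u)

  two-terms≤∑² : ∀ {a b c d} → ¬ (a ≡ c × b ≡ d) → H a b + H c d ≤ ∑²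
  two-terms≤∑² {a} {b} {c} {d} ne with a ≟ c
  ... | yes refl = ≤-trans (two-terms≤∑ (H a) (λ b≡d → ne (refl , b≡d))) (term≤∑ (λ u → ∑ (H u)) a)
  ... | no a≢c = ≤-trans (+-mono-≤ (term≤∑ (H a) b) (term≤∑ (H c) d)) (two-terms≤∑ (λ u → ∑ (H u)) a≢c)

  ∑²-single : ∀ a b → (∀ u v → ¬ (u ≡ a × v ≡ b) → H u v ≡ 0) → ∑² ≡ H a b
  ∑²-single a b H≡0 = trans (∑-single _ a row≡0) (∑-single (H a) b (λ v v≢b → H≡0 a v (v≢b ∘ proj₂)))
    where
    row≡0 : ∀ u → u ≢ a → ∑ (H u) ≡ 0
    row≡0 u u≢a = trans (∑-single (H u) b (λ v _ → H≡0 u v (u≢a ∘ proj₁))) (H≡0 u b (u≢a ∘ proj₁))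

Least : (ℕ → Set) → Set
Least P = ∃ λ m → P m × ∀ k → P k → m ≤ k

least : ∀ {P : ℕ → Set} → Decidable P → ∀ n → P n → Least P
least P? zero P0 = 0 , P0 , λ _ _ → z≤n
least P? (suc n) Pn with P? 0
... | yes P0 = 0 , P0 , λ _ _ → z≤n
... | no ¬P0 with least (P? ∘ suc) n Pn
...   | m , Psm , min = suc m , Psm , λ { zero P0 → contradiction P0 ¬P0 ; (suc k) Psk → s≤s (min k Psk) }

dec-witness : ∀ {A : Set} (A? : Dec A) → does A? ≡ true → A
dec-witness (true because [a]) _ = invert [a]

last-or-inject₁ : ∀ {n} (i : Fin (suc n)) → i ≡ fromℕ n ⊎ ∃ λ j → i ≡ inject₁ j
last-or-inject₁ {zero} fzero = inj₁ refl
last-or-inject₁ {suc n} fzero = inj₂ (fzero , refl)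
last-or-inject₁ {suc n} (fsuc i) with last-or-inject₁ i
... | inj₁ refl = inj₁ refl
... | inj₂ (j , refl) = inj₂ (fsuc j , refl)

module _ {p : ℕ} {R : Fin p → Fin p → Bool} where

  _++ᵂ_ : ∀ {a b c} → Walk R a b → Walk R b c → Walk R a c
  here ++ᵂ w = w
  step r v ++ᵂ w = step r (v ++ᵂ w)

  reverseᵂ : (∀ u v → R u v ≡ R v u) → ∀ {a b} → Walk R a b → Walk R b a
  reverseᵂ R-sym here = here
  reverseᵂ R-sym (step {u} {v} r w) = reverseᵂ R-sym w ++ᵂ step (trans (R-sym v u) r) here

  crossing-edge : ∀ {A : Set} → DecidableEquality A → (h : Fin p → A) → ∀ {a b} →
                  Walk R a b → h a ≢ h b → ∃₂ λ s t → R s t ≡ true × h s ≢ h t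
  crossing-edge _≟ᴬ_ h here ha≢hb = contradiction refl ha≢hb
  crossing-edge _≟ᴬ_ h {a} (step {v = s} r w) ha≢hb with h a ≟ᴬ h s
  ... | yes ha≡hs = crossing-edge _≟ᴬ_ h w (ha≢hb ∘ trans ha≡hs)
  ... | no ha≢hs = a , s , r , ha≢hs

  module _ (R-sym : ∀ u v → R u v ≡ R v u) (C : Cycle R) where
    open Cycle C

    cycle-neighbours : ∀ j → ∃₂ λ i₁ i₂ → i₁ ≢ i₂ × R (c j) (c i₁) ≡ true × R (c j) (c i₂) ≡ true
    cycle-neighbours fzero =
      fsuc fzero , fromℕ (suc (suc k)) , (λ ()) , consec fzero , trans (R-sym _ _) close
    cycle-neighbours (fsuc i) with last-or-inject₁ i
    ... | inj₁ refl = inject₁ i , fzero , (λ ()) , trans (R-sym _ _) (consec i) , close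
    ... | inj₂ (j , refl) =
      inject₁ (inject₁ j) , fsuc (fsuc j) , inject₁²≢suc² , trans (R-sym _ _) (consec (inject₁ j)) , consec (fsuc j)
      where
      inject₁²≢suc² : inject₁ (inject₁ j) ≢ fsuc (fsuc j)
      inject₁²≢suc² eq =
        m≢1+n+m (toℕ j) (trans (sym (trans (toℕ-inject₁ (inject₁ j)) (toℕ-inject₁ j))) (cong toℕ eq))

adjacent⇒≢ : ∀ {p} (G : Graph p) {u v} → adj G u v ≡ true → u ≢ v
adjacent⇒≢ G {u} e refl with () ← trans (sym (irrefl G u)) e

module ParentTree {p : ℕ} (G : Graph p) (root : Fin p) (par : Fin p → Fin p) (rank : Fin p → ℕ)
  (par-step : ∀ x → x ≢ root → adj G (par x) x ≡ true × rank (par x) < rank x) where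

  ParentOf : Fin p → Fin p → Set
  ParentOf a b = b ≢ root × a ≡ par b

  parentOf? : ∀ a b → Dec (ParentOf a b)
  parentOf? a b = ¬? (b ≟ root) ×-dec (a ≟ par b)

  tree : Fin p → Fin p → Bool
  tree a b = does (parentOf? a b ⊎-dec parentOf? b a)

  tree-sym : ∀ a b → tree a b ≡ tree b a
  tree-sym a b = ∨-comm (does (parentOf? a b)) (does (parentOf? b a))

  tree-edge : ∀ a b → tree a b ≡ true → ParentOf a b ⊎ ParentOf b a
  tree-edge a b = dec-witness (parentOf? a b ⊎-dec parentOf? b a)

  parent-edge : ∀ {a b} → ParentOf a b → tree a b ≡ true
  parent-edge {a} {b} pa = dec-true (parentOf? a b ⊎-dec parentOf? b a) (inj₁ pa)

  child-edge : ∀ {x} → x ≢ root → tree x (par x) ≡ true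
  child-edge {x} x≢root = dec-true (parentOf? x (par x) ⊎-dec parentOf? (par x) x) (inj₂ (x≢root , refl))

  tree⊆G : ∀ a b → tree a b ≡ true → adj G a b ≡ true
  tree⊆G a b e with tree-edge a b e
  ... | inj₁ (b≢root , refl) = proj₁ (par-step b b≢root)
  ... | inj₂ (a≢root , refl) = trans (Graph.sym G a _) (proj₁ (par-step a a≢root))

  path-to-root : ∀ n x → rank x < n → Walk tree x root
  path-to-root (suc n) x rank<1+n with x ≟ root
  ... | yes refl = here
  ... | no x≢root =
    step (child-edge x≢root) (path-to-root n (par x) (<-≤-trans (proj₂ (par-step x x≢root)) (≤-pred rank<1+n)))

  tree-connected : Connected tree
  tree-connected a b = path-to-root _ a (n<1+n _) ++ᵂ reverseᵂ tree-sym (path-to-root _ b (n<1+n _))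

  edge-down⇒parent : ∀ x y → tree x y ≡ true → rank y ≤ rank x → y ≡ par x
  edge-down⇒parent x y e ry≤rx with tree-edge x y e
  ... | inj₁ (y≢root , refl) = contradiction (<-≤-trans (proj₂ (par-step y y≢root)) ry≤rx) (<-irrefl refl)
  ... | inj₂ (_ , y≡par-x) = y≡par-x

  -- Both cycle-neighbours of a vertex of largest rank on a cycle would have to be its parent.
  tree-acyclic : Acyclic tree
  tree-acyclic C = two-parents (cycle-neighbours {R = tree} tree-sym C top)
    where
    open Cycle C
    top : Fin (suc (suc (suc k)))
    top = argmax (rank ∘ c) fzero (allFin _)
    top-max : ∀ i → rank (c i) ≤ rank (c top)
    top-max i = lookup (f[xs]≤f[argmax] {f = rank ∘ c} fzero (allFin _)) (∈-allFin i)
    two-parents : (∃₂ λ i₁ i₂ → i₁ ≢ i₂ × tree (c top) (c i₁) ≡ true × tree (c top) (c i₂) ≡ true) → ⊥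
    two-parents (i₁ , i₂ , i₁≢i₂ , e₁ , e₂) = i₁≢i₂ (inj (begin
      c i₁         ≡⟨ edge-down⇒parent _ (c i₁) e₁ (top-max i₁) ⟩
      par (c top)  ≡⟨ edge-down⇒parent _ (c i₂) e₂ (top-max i₂) ⟨
      c i₂         ∎))
      where open ≡-Reasoning

  isSpanningTree : SpanningTree G tree
  isSpanningTree = record { sub = tree⊆G ; tsym = tree-sym ; conn = tree-connected ; acyc = tree-acyclic }

module BreadthFirst {p : ℕ} (G : Graph p) (connected : ConnectedGraph G) (root : Fin p) where

  Reach : ℕ → Fin p → Set
  Reach zero x = x ≡ root
  Reach (suc k) x = Reach k x ⊎ ∃ λ w → Reach k w × adj G w x ≡ true

  reach? : ∀ k x → Dec (Reach k x)
  reach? zero x = x ≟ root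
  reach? (suc k) x = reach? k x ⊎-dec any? (λ w → reach? k w ×-dec (adj G w x ≟ᵇ true))

  reach-along : ∀ {k a x} → Walk (adj G) a x → Reach k a → ∃ λ k′ → Reach k′ x
  reach-along here r = _ , r
  reach-along (step e w) r = reach-along w (inj₂ (_ , r , e))

  depth : ∀ x → Least (λ k → Reach k x)
  depth x = least (λ k → reach? k x) _ (proj₂ (reach-along (connected root x) refl))

  rank : Fin p → ℕ
  rank x = proj₁ (depth x)

  reach-rank : ∀ x → Reach (rank x) x
  reach-rank x = proj₁ (proj₂ (depth x))

  rank-minimal : ∀ {x} k → Reach k x → rank x ≤ k
  rank-minimal {x} = proj₂ (proj₂ (depth x))

  lower-neighbour : ∀ x → x ≢ root → ∃ λ w → adj G w x ≡ true × rank w < rank x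
  lower-neighbour x x≢root with rank x | reach-rank x | rank-minimal {x}
  ... | zero | x≡root | _ = contradiction x≡root x≢root
  ... | suc k | inj₁ reach-k | minimal = contradiction (minimal k reach-k) 1+n≰n
  ... | suc k | inj₂ (w , reach-w , e) | _ = w , e , s≤s (rank-minimal k reach-w)

  -- the root is its own parent; par is only ever used away from the root
  par : Fin p → Fin p
  par x with x ≟ root
  ... | yes _ = root
  ... | no x≢root = proj₁ (lower-neighbour x x≢root)

  par-step : ∀ x → x ≢ root → adj G (par x) x ≡ true × rank (par x) < rank x
  par-step x x≢root with x ≟ root
  ... | yes x≡root = contradiction x≡root x≢root
  ... | no x≢root′ = proj₂ (lower-neighbour x x≢root′)

  open ParentTree G root par rank par-step public

  -- A neighbour of the root has rank 1, so its parent has rank 0 and is the root.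
  root-edge-in-tree : ∀ {v} → adj G root v ≡ true → tree root v ≡ true
  root-edge-in-tree {v} e = parent-edge (v≢root , sym (rank≡0⇒root (n<1⇒n≡0 rank-par<1)))
    where
    v≢root : v ≢ root
    v≢root = adjacent⇒≢ G e ∘ sym
    rank-par<1 : rank (par v) < 1
    rank-par<1 = <-≤-trans (proj₂ (par-step v v≢root)) (rank-minimal 1 (inj₂ (root , refl , e)))
    rank≡0⇒root : ∀ {x} → rank x ≡ 0 → x ≡ root
    rank≡0⇒root {x} rank≡0 = subst (λ k → Reach k x) rank≡0 (reach-rank x)

spanning-tree-through : ∀ {p} (G : Graph p) → ConnectedGraph G → ∀ {u v} → adj G u v ≡ true →
                        ∃ λ T → SpanningTree G T × T u v ≡ true
spanning-tree-through G connected {u} e = tree , isSpanningTree , root-edge-in-tree e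
  where open BreadthFirst G connected u

module _ {p : ℕ} (f : Labelling p) where

  parity : Fin p → ℕ
  parity v = label f v % 2

  parity≢⇒negative : ∀ {u v} → parity u ≢ parity v → Negative f u v
  parity≢⇒negative {u} {v} ne with parity u ≡ᵇ parity v | ≡ᵇ⇒≡ (parity u) (parity v)
  ... | true | eq = contradiction (eq _) ne
  ... | false | _ = refl

  negative⇒parity≢ : ∀ {u v} → Negative f u v → parity u ≢ parity v
  negative⇒parity≢ {u} {v} neg eq with parity u ≡ᵇ parity v | ≡⇒≡ᵇ (parity u) (parity v) eq
  negative⇒parity≢ () eq | true | _

  negative-sym : ∀ {u v} → Negative f u v → Negative f v u
  negative-sym neg = parity≢⇒negative (negative⇒parity≢ neg ∘ sym)

-- f ⟨$⟩ˡ i is the vertex labelled i + 1.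
labels-1-2-parity≢ : ∀ {n} (f : Labelling (suc (suc n))) →
                     parity f (f ⟨$⟩ˡ fzero) ≢ parity f (f ⟨$⟩ˡ fsuc fzero)
labels-1-2-parity≢ f rewrite inverseʳ f {fzero} | inverseʳ f {fsuc fzero} = λ ()

negative-edge-exists : ∀ {p} (G : Graph p) → ConnectedGraph G → (f g : Labelling p) → 1 ≤ negCount G g →
                       ∃₂ λ a b → adj G a b ≡ true × Negative f a b
negative-edge-exists {zero} _ _ _ _ ()
negative-edge-exists {suc zero} _ _ _ _ ()
negative-edge-exists {suc (suc n)} G connected f _ _
  with crossing-edge ℕ._≟_ (parity f) (connected _ _) (labels-1-2-parity≢ f)
... | a , b , e , ne = a , b , e , parity≢⇒negative f ne

SameEnds : ∀ {p} → Fin p → Fin p → Fin p → Fin p → Set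
SameEnds a b u v = (u ≡ a × v ≡ b) ⊎ (u ≡ b × v ≡ a)

sameEnds-sym : ∀ {p} {a b u v : Fin p} → SameEnds a b u v → SameEnds u v a b
sameEnds-sym (inj₁ (refl , refl)) = inj₁ (refl , refl)
sameEnds-sym (inj₂ (refl , refl)) = inj₂ (refl , refl)

sameEnds-transport : ∀ {p} (P : Fin p → Fin p → Set) → (∀ {x y} → P x y → P y x) →
                     ∀ {a b u v} → P a b → SameEnds a b u v → P u v
sameEnds-transport P P-sym Pab (inj₁ (refl , refl)) = Pab
sameEnds-transport P P-sym Pab (inj₂ (refl , refl)) = P-sym Pab

InEveryTree : ∀ {p} (G : Graph p) → Edge G → Set
InEveryTree G e = ∀ T → SpanningTree G T → ∀ u v → IsEdge {G = G} e u v → T u v ≡ true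

module _ {p : ℕ} (G : Graph p) (f : Labelling p) where

  -- negCount counts every negative edge once, as the arc from its smaller to its larger end.
  NegativeArc : Fin p → Fin p → Set
  NegativeArc u v = toℕ u < toℕ v × adj G u v ≡ true × Negative f u v

  negIndicator : Fin p → Fin p → ℕ
  negIndicator u v = if (toℕ u <ᵇ toℕ v) ∧ adj G u v ∧ negB f u v then 1 else 0

  negCount≡∑² : negCount G f ≡ ∑² negIndicator
  negCount≡∑² =
    cong sum (trans (map-tabulate id _) (tabulate-cong λ u → cong sum (map-tabulate id (negIndicator u))))

  negIndicator-arc : ∀ {u v} → NegativeArc u v → negIndicator u v ≡ 1
  negIndicator-arc {u} {v} (u<v , e , neg) rewrite Equivalence.to T-≡ (<⇒<ᵇ u<v) | e | neg = refl

  negIndicator-non-arc : ∀ {u v} → ¬ NegativeArc u v → negIndicator u v ≡ 0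
  negIndicator-non-arc {u} {v} ¬arc with toℕ u <ᵇ toℕ v in lt | adj G u v | negB f u v
  ... | true  | true  | true  = contradiction (<ᵇ⇒< _ _ (Equivalence.from T-≡ lt) , refl , refl) ¬arc
  ... | true  | true  | false = refl
  ... | true  | false | _     = refl
  ... | false | _     | _     = refl

  negCount≤1⇒arc-unique : negCount G f ≤ 1 → ∀ {a b c d} → NegativeArc a b → NegativeArc c d → a ≡ c × b ≡ d
  negCount≤1⇒arc-unique count≤1 {a} {b} {c} {d} arc₁ arc₂ with (a ≟ c) ×-dec (b ≟ d)
  ... | yes same = same
  ... | no different = contradiction (≤-trans 2≤count count≤1) λ { (s≤s ()) }
    where
    2≤count : 2 ≤ negCount G f
    2≤count = begin
      2                                    ≡⟨ cong₂ _+_ (negIndicator-arc arc₁) (negIndicator-arc arc₂) ⟨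
      negIndicator a b + negIndicator c d  ≤⟨ two-terms≤∑² negIndicator different ⟩
      ∑² negIndicator                      ≡⟨ negCount≡∑² ⟨
      negCount G f                         ∎
      where open ℕ.≤-Reasoning

  arc-unique⇒negCount≡1 : ∀ {a b} → NegativeArc a b → (∀ u v → NegativeArc u v → u ≡ a × v ≡ b) →
                          negCount G f ≡ 1
  arc-unique⇒negCount≡1 {a} {b} arc unique = begin
    negCount G f     ≡⟨ negCount≡∑² ⟩
    ∑² negIndicator  ≡⟨ ∑²-single negIndicator a b (λ u v ne → negIndicator-non-arc (ne ∘ unique u v)) ⟩
    negIndicator a b ≡⟨ negIndicator-arc arc ⟩
    1                ∎
    where open ≡-Reasoning

  orient : ∀ {s t} → adj G s t ≡ true → Negative f s t → NegativeArc s t ⊎ NegativeArc t s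
  orient {s} {t} e neg with <-cmp (toℕ s) (toℕ t)
  ... | tri< s<t _ _ = inj₁ (s<t , e , neg)
  ... | tri≈ _ s≡t _ = contradiction (toℕ-injective s≡t) (adjacent⇒≢ G e)
  ... | tri> _ _ t<s = inj₂ (t<s , trans (Graph.sym G t s) e , negative-sym f neg)

  OnlyNegativeEdge : Fin p → Fin p → Set
  OnlyNegativeEdge a b = ∀ s t → adj G s t ≡ true → Negative f s t → SameEnds a b s t

  UniqueNegativeEdge : Edge G → Set
  UniqueNegativeEdge (a , b , _) = Negative f a b × OnlyNegativeEdge a b

  arc-unique⇒edge-unique : ∀ {a b} → (∀ u v → NegativeArc u v → u ≡ a × v ≡ b) → OnlyNegativeEdge a b
  arc-unique⇒edge-unique unique s t e neg with orient e neg
  ... | inj₁ arc = inj₁ (unique s t arc)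
  ... | inj₂ arc = inj₂ (swap (unique t s arc))

  edge-unique⇒arc-unique : ∀ {a b} → NegativeArc a b → OnlyNegativeEdge a b →
                           ∀ u v → NegativeArc u v → u ≡ a × v ≡ b
  edge-unique⇒arc-unique (a<b , _) only u v (u<v , e , neg) with only u v e neg
  ... | inj₁ same = same
  ... | inj₂ (refl , refl) = contradiction a<b (<-asym u<v)

  onlyNegativeEdge-swap : ∀ {a b} → OnlyNegativeEdge a b → OnlyNegativeEdge b a
  onlyNegativeEdge-swap only s t e neg = swap⊎ (only s t e neg)

  negCount≤1⇒unique-negative-edge : negCount G f ≤ 1 → ∀ {a b} (e : adj G a b ≡ true) → Negative f a b →
                                    UniqueNegativeEdge (a , b , e)
  negCount≤1⇒unique-negative-edge count≤1 e neg with orient e neg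
  ... | inj₁ arc = neg , arc-unique⇒edge-unique (λ u v arc′ → negCount≤1⇒arc-unique count≤1 arc′ arc)
  ... | inj₂ arc =
    neg , onlyNegativeEdge-swap (arc-unique⇒edge-unique (λ u v arc′ → negCount≤1⇒arc-unique count≤1 arc′ arc))

  unique-negative-edge⇒negCount≡1 : ∀ e → UniqueNegativeEdge e → negCount G f ≡ 1
  unique-negative-edge⇒negCount≡1 (a , b , ab) (neg , only) with orient ab neg
  ... | inj₁ arc = arc-unique⇒negCount≡1 arc (edge-unique⇒arc-unique arc only)
  ... | inj₂ arc = arc-unique⇒negCount≡1 arc (edge-unique⇒arc-unique arc (onlyNegativeEdge-swap only))

  NegativeTreeEdgesAre : Edge G → Set
  NegativeTreeEdgesAre e =
    ∀ T → SpanningTree G T → ∀ u v → ((T u v ≡ true × Negative f u v) ⇔ IsEdge {G = G} e u v)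

  unique⇒in-every-tree : ∀ e → UniqueNegativeEdge e → InEveryTree G e
  unique⇒in-every-tree (a , b , _) (neg , only) T isTree u v = tree-edge-transport T-ab
    where
    open SpanningTree isTree
    tree-edge-transport : ∀ {x y u v} → T x y ≡ true → SameEnds x y u v → T u v ≡ true
    tree-edge-transport = sameEnds-transport (λ x y → T x y ≡ true) (λ {x} {y} → trans (tsym y x))
    T-ab : T a b ≡ true
    T-ab with crossing-edge ℕ._≟_ (parity f) (conn a b) (negative⇒parity≢ f neg)
    ... | s , t , T-st , ne =
      tree-edge-transport T-st (sameEnds-sym (only s t (sub s t T-st) (parity≢⇒negative f ne)))

  unique⇒negative-tree-edges : ∀ e → UniqueNegativeEdge e → NegativeTreeEdgesAre e
  unique⇒negative-tree-edges e unique@(neg , only) T isTree u v = mk⇔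
    (λ (T-uv , neg-uv) → only u v (SpanningTree.sub isTree u v T-uv) neg-uv)
    (λ ends → unique⇒in-every-tree e unique T isTree u v ends ,
              sameEnds-transport (Negative f) (negative-sym f) neg ends)

  negative-tree-edges⇒unique : ConnectedGraph G → ∀ e → NegativeTreeEdgesAre e → UniqueNegativeEdge e
  negative-tree-edges⇒unique connected (a , b , ab) negatives = neg , only
    where
    neg : Negative f a b
    neg with spanning-tree-through G connected ab
    ... | T , isTree , _ = proj₂ (Equivalence.from (negatives T isTree a b) (inj₁ (refl , refl)))
    only : OnlyNegativeEdge a b
    only s t st neg-st with spanning-tree-through G connected st
    ... | T , isTree , T-st = Equivalence.to (negatives T isTree s t) (T-st , neg-st)

mainTheorem12 : ∀ {p : ℕ} (G : Graph p) → ConnectedGraph G →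
    (f : Labelling p) → IsRNA G f →
    RnaNumberIs G 1 ⇔
      Σ (Edge G) (λ e →
        (∀ T → SpanningTree G T → ∀ u v → IsEdge {G = G} e u v → T u v ≡ true)
        × (∀ T → SpanningTree G T → ∀ (u v : Fin p) →
             ((T u v ≡ true × Negative f u v) ⇔ IsEdge {G = G} e u v)))
mainTheorem12 G connected f rna = mk⇔ forward backward
  where
  forward : RnaNumberIs G 1 → Σ (Edge G) λ e → InEveryTree G e × NegativeTreeEdgesAre G f e
  forward (g , _ , negCount-g≡1) with negative-edge-exists G connected f g (≤-reflexive (sym negCount-g≡1))
  ... | a , b , ab , neg =
    edge , unique⇒in-every-tree G f edge unique , unique⇒negative-tree-edges G f edge unique
    where
    edge : Edge G
    edge = a , b , ab
    unique : UniqueNegativeEdge G f edge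
    unique = negCount≤1⇒unique-negative-edge G f (subst (negCount G f ≤_) negCount-g≡1 (rna g)) ab neg

  backward : (Σ (Edge G) λ e → InEveryTree G e × NegativeTreeEdgesAre G f e) → RnaNumberIs G 1
  backward (e , _ , negatives) =
    f , rna , unique-negative-edge⇒negCount≡1 G f e (negative-tree-edges⇒unique G f connected e negatives)
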